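{- Let $n \ge 2$ and let $S_1[1..n]$ and $S_2[1..n]$ be two strings whose $2n$ entries are independent and identically distributed random numbers, under the assumption that no two entries within a string are equal. For $j \ge 0$ let $p(j)$ denote the probability that two such independent length-$j$ strings have the same Cartesian tree, with $p(0)=1$ and $p(1)=1$. Then $$p(n) = \frac{p(0)p(n-1)+p(1)p(n-2)+\dots+p(n-1)p(0)}{n^2} = \frac{1}{n^2}\sum_{i=1}^{n} p(i-1)\,p(n-i).$$
   Context: The Cartesian tree $CT(S)$ of a string $S[1..n]$ (a sequence of numbers) is defined recursively: if $S$ is empty, $CT(S)$ is the empty tree; otherwise, if $S[i]$ is the minimum value in $S[1..n]$ (the leftmost one if there are several), $CT(S)$ is the binary tree with root $S[i]$, left subtree $CT(S[1..i-1])$ and right subtree $CT(S[i+1..n])$. Two strings "have the same Cartesian tree" if their Cartesian trees are equal as (unlabeled) binary tree shapes. $S[i..j]$ denotes the substring from position $i$ to position $j$. -}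

module Defs where

open import Data.Nat using (ℕ; zero; suc; _≤ᵇ_; _∸_; _*_)
open import Data.Nat.Properties using (_!*_!≢0)
open import Data.Nat using (_!)
open import Data.Bool using (if_then_else_)
open import Data.List using (List; []; _∷_; length; take; drop; map; concatMap; cartesianProduct; filter; foldr; upTo)
open import Data.Product using (_×_; _,_; proj₁; proj₂)
open import Data.Integer using (+_)
open import Data.Rational using (ℚ; _/_; 0ℚ) renaming (_+_ to _+ℚ_; _*_ to _*ℚ_)
open import Relation.Binary.PropositionalEquality using (_≡_; refl; cong₂)
open import Relation.Nullary using (Dec; yes; no)
open import Relation.Nullary.Decidable using (map′)
open import Data.Product using (uncurry)

data Tree : Set where
  leaf : Tree
  node : Tree → Tree → Tree

node-injₗ : ∀ {a b c d} → node a b ≡ node c d → a ≡ c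
node-injₗ refl = refl
node-injᵣ : ∀ {a b c d} → node a b ≡ node c d → b ≡ d
node-injᵣ refl = refl

_≟T_ : (s t : Tree) → Dec (s ≡ t)
leaf ≟T leaf = yes refl
leaf ≟T node _ _ = no (λ ())
node _ _ ≟T leaf = no (λ ())
node a b ≟T node c d with a ≟T c | b ≟T d
... | yes refl | yes refl = yes refl
... | no ¬p | _ = no (λ e → ¬p (node-injₗ e))
... | _ | no ¬q = no (λ e → ¬q (node-injᵣ e))

-- (value, index) of the leftmost minimum of a nonempty list x ∷ xs (0-based index).
minIdx : ℕ → List ℕ → ℕ × ℕ
minIdx x [] = x , 0
minIdx x (y ∷ ys) with minIdx y ys
... | (m , i) = if x ≤ᵇ m then (x , 0) else (m , suc i)

-- Cartesian tree with fuel (fuel = length suffices, since each recursive call is on a shorter list).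
ctFuel : ℕ → List ℕ → Tree
ctFuel zero _ = leaf
ctFuel (suc k) [] = leaf
ctFuel (suc k) (x ∷ xs) =
  let i = proj₂ (minIdx x xs) ; s = x ∷ xs in
  node (ctFuel k (take i s)) (ctFuel k (drop (suc i) s))

CT : List ℕ → Tree
CT s = ctFuel (length s) s

insertions : ℕ → List ℕ → List (List ℕ)
insertions x [] = (x ∷ []) ∷ []
insertions x (y ∷ ys) = (x ∷ y ∷ ys) ∷ map (y ∷_) (insertions x ys)

permsOf : List ℕ → List (List ℕ)
permsOf [] = [] ∷ []
permsOf (x ∷ xs) = concatMap (insertions x) (permsOf xs)

-- All n! permutations of 0,1,…,n-1 (the possible relative orders of n distinct numbers).
perms : ℕ → List (List ℕ)
perms n = permsOf (upTo n)

sameCTCount : ℕ → ℕ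
sameCTCount n =
  length (filter (λ st → CT (proj₁ st) ≟T CT (proj₂ st)) (cartesianProduct (perms n) (perms n)))

-- p(n): probability that two independent uniformly random orderings
-- (equivalently two strings of n distinct iid random numbers) have the same Cartesian tree.
p : ℕ → ℚ
p n = ((+ sameCTCount n) / (n ! * n !)) {{n !* n !≢0}}

convSum : ℕ → ℚ
convSum n = foldr _+ℚ_ 0ℚ (map (λ i → p i *ℚ p (n ∸ suc i)) (upTo n))

{-# OPTIONS --safe #-}
module Submission where

-- The minimum of a permutation σ of length n + 1 sits at some position k, and σ arises from a
-- permutation ρ of length n by shifting its values up and inserting 0 at position k. The tree of σ
-- is then a root over the trees of take k ρ and drop k ρ, and these two trees are determined by k
-- and CT ρ alone (split). By induction on n it follows that, as s ranges over the permutations of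
-- length n, the pair (CT (take j s), CT (drop j s)) takes each value (CT α, CT β), for α and β
-- permutations of lengths j and n ∸ j, exactly C(n, j) times. Two permutations of length n + 1
-- have the same tree iff their minima sit at the same position k and the trees on both sides
-- agree, so the number Q of such pairs satisfies Q(n + 1) = Σₖ C(n, k)² Q(k) Q(n ∸ k). As
-- p(n) = Q(n) / (n!)² and C(n, k) = n! / (k! (n ∸ k)!), dividing by ((n + 1)!)² gives the
-- recurrence.

open import Defs
open import Algebra.Properties.CommutativeSemigroup using (interchange)
open import Data.Bool using (true; false; if_then_else_; T)
open import Data.Integer as ℤ using (+_)
open import Data.Integer.Properties using (pos-*; pos-+)
open import Data.List
  using (List; []; _∷_; _++_; length; take; drop; map; foldr; concatMap; filter; cartesianProduct; upTo; applyUpTo)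
open import Data.List.Properties
  using (length-++; length-map; length-take; length-upTo; ∷-injective; ++-conicalʳ; map-++; map-∘; take-map; drop-map;
         map-applyUpTo; concatMap-map; concatMap-cong; map-concatMap)
open import Data.List.Relation.Unary.All as All using (All; []; _∷_)
open import Data.List.Relation.Unary.All.Properties using (++⁺; ++⁻ʳ; map⁺; take⁺; drop⁺; concat⁺)
open import Data.Nat
  using (ℕ; zero; suc; _+_; _*_; _∸_; _≤_; _<_; z≤n; s≤s; z<s; s<s; _≤ᵇ_; _≤?_; _!; NonZero)
open import Data.Nat.Combinatorics
  using (_C_; nCk≡n!/k![n-k]!; k![n∸k]!∣n!; nCk+nC[k+1]≡[n+1]C[k+1]; k>n⇒nCk≡0)
open import Data.Nat.DivMod using (m/n*n≡m)
open import Data.Nat.Properties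
open import Data.Nat.Solver using (module +-*-Solver)
open import Data.Product as Product using (∃; _×_; _,_; proj₁; proj₂; uncurry)
open import Data.Rational using (ℚ; _/_; 0ℚ; toℚᵘ; fromℚᵘ) renaming (_+_ to _+ℚ_; _*_ to _*ℚ_)
open import Data.Rational.Properties
  using (toℚᵘ-injective; fromℚᵘ-cong; toℚᵘ-fromℚᵘ; toℚᵘ-homo-*; toℚᵘ-homo-+; /-cong; 0/n≡0)
open import Data.Rational.Unnormalised as ℚᵘ using (mkℚᵘ; *≡*)
import Data.Rational.Unnormalised.Properties as ℚᵘ
open import Data.Sum as Sum using (_⊎_; inj₁; inj₂)
open import Data.Unit using (tt)
open import Function using (_∘_; id)
open import Level using (0ℓ)
open import Relation.Binary.Core using (_Preserves_⟶_)
open import Relation.Binary.PropositionalEquality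
open import Relation.Nullary using (Dec; yes; no; does)
open import Relation.Nullary.Negation using (contradiction)
open import Relation.Unary using (Pred; Decidable)

open +-*-Solver using (solve; _:=_; _:+_; _:*_; con)

private variable
  A B : Set
  k j n : ℕ
  t u : Tree

-- Finite sums

∑ : List A → (A → ℕ) → ℕ
∑ []       f = 0
∑ (x ∷ xs) f = f x + ∑ xs f

syntax ∑ xs (λ x → e) = ∑[ x ← xs ] e

∑< : ℕ → (ℕ → ℕ) → ℕ
∑< zero    f = 0
∑< (suc n) f = f 0 + ∑< n (f ∘ suc)

syntax ∑< n (λ k → e) = ∑[ k < n ] e

module _ {A : Set} where

  ∑-cong : ∀ (xs : List A) {f g} → (∀ x → f x ≡ g x) → ∑ xs f ≡ ∑ xs g
  ∑-cong []       _   = refl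
  ∑-cong (x ∷ xs) f≗g = cong₂ _+_ (f≗g x) (∑-cong xs f≗g)

  ∑-congᴬ : ∀ {xs : List A} {f g} → All (λ x → f x ≡ g x) xs → ∑ xs f ≡ ∑ xs g
  ∑-congᴬ []         = refl
  ∑-congᴬ (eq ∷ eqs) = cong₂ _+_ eq (∑-congᴬ eqs)

  ∑-zero : ∀ (xs : List A) → ∑[ x ← xs ] 0 ≡ 0
  ∑-zero []       = refl
  ∑-zero (x ∷ xs) = ∑-zero xs

  ∑-++ : ∀ (xs ys : List A) f → ∑ (xs ++ ys) f ≡ ∑ xs f + ∑ ys f
  ∑-++ []       ys f = refl
  ∑-++ (x ∷ xs) ys f = trans (cong (_+_ (f x)) (∑-++ xs ys f)) (sym (+-assoc (f x) _ _))

  ∑-+ : ∀ (xs : List A) f g → ∑[ x ← xs ] (f x + g x) ≡ ∑ xs f + ∑ xs g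
  ∑-+ []       f g = refl
  ∑-+ (x ∷ xs) f g =
    trans (cong (_+_ (f x + g x)) (∑-+ xs f g)) (interchange +-commutativeSemigroup (f x) (g x) _ _)

  ∑-*ˡ : ∀ (xs : List A) c f → ∑[ x ← xs ] (c * f x) ≡ c * ∑ xs f
  ∑-*ˡ []       c f = sym (*-zeroʳ c)
  ∑-*ˡ (x ∷ xs) c f = trans (cong (_+_ (c * f x)) (∑-*ˡ xs c f)) (sym (*-distribˡ-+ c (f x) _))

∑-map : ∀ (g : A → B) xs f → ∑ (map g xs) f ≡ ∑ xs (f ∘ g)
∑-map g []       f = refl
∑-map g (x ∷ xs) f = cong (_+_ (f (g x))) (∑-map g xs f)

∑-concatMap : ∀ (g : A → List B) xs f → ∑ (concatMap g xs) f ≡ ∑[ x ← xs ] ∑ (g x) f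
∑-concatMap g []       f = refl
∑-concatMap g (x ∷ xs) f = trans (∑-++ (g x) _ f) (cong (_+_ (∑ (g x) f)) (∑-concatMap g xs f))

∑-cartesianProduct : ∀ (xs : List A) (ys : List B) f →
                     ∑ (cartesianProduct xs ys) f ≡ ∑[ x ← xs ] ∑[ y ← ys ] f (x , y)
∑-cartesianProduct []       ys f = refl
∑-cartesianProduct (x ∷ xs) ys f =
  trans (∑-++ (map (x ,_) ys) _ f) (cong₂ _+_ (∑-map (x ,_) ys f) (∑-cartesianProduct xs ys f))

∑-*-∑ : ∀ (xs : List A) (ys : List B) f g → ∑ xs f * ∑ ys g ≡ ∑[ x ← xs ] ∑[ y ← ys ] (f x * g y)
∑-*-∑ []       ys f g = refl
∑-*-∑ (x ∷ xs) ys f g =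
  trans (*-distribʳ-+ (∑ ys g) (f x) _) (cong₂ _+_ (sym (∑-*ˡ ys (f x) g)) (∑-*-∑ xs ys f g))

∑∑-*-∑∑ : ∀ {A A′ B B′ : Set} (xs : List A) (xs′ : List A′) (ys : List B) (ys′ : List B′)
          (f : A → A′ → ℕ) (g : B → B′ → ℕ) →
          (∑[ x ← xs ] ∑[ x′ ← xs′ ] f x x′) * (∑[ y ← ys ] ∑[ y′ ← ys′ ] g y y′)
          ≡ ∑[ x ← xs ] ∑[ y ← ys ] ∑[ x′ ← xs′ ] ∑[ y′ ← ys′ ] (f x x′ * g y y′)
∑∑-*-∑∑ xs xs′ ys ys′ f g =
  trans (∑-*-∑ xs ys _ _) (∑-cong xs (λ x → ∑-cong ys (λ y → ∑-*-∑ xs′ ys′ (f x) (g y))))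

∑<-cong : ∀ n {f g} → (∀ k → k < n → f k ≡ g k) → ∑< n f ≡ ∑< n g
∑<-cong zero    _   = refl
∑<-cong (suc n) f≗g = cong₂ _+_ (f≗g 0 z<s) (∑<-cong n (λ k k< → f≗g (suc k) (s<s k<)))

∑<-zero : ∀ n → ∑[ k < n ] 0 ≡ 0
∑<-zero zero    = refl
∑<-zero (suc n) = ∑<-zero n

∑<-+ : ∀ a b (f : ℕ → ℕ) → ∑< (a + b) f ≡ ∑< a f + ∑[ t < b ] f (a + t)
∑<-+ zero    b f = refl
∑<-+ (suc a) b f = trans (cong (_+_ (f 0)) (∑<-+ a b (f ∘ suc))) (sym (+-assoc (f 0) _ _))

∑<-∑ : ∀ n (xs : List A) (f : ℕ → A → ℕ) →
       ∑[ k < n ] ∑[ x ← xs ] f k x ≡ ∑[ x ← xs ] ∑[ k < n ] f k x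
∑<-∑ zero    xs f = sym (∑-zero xs)
∑<-∑ (suc n) xs f = trans (cong (_+_ (∑ xs (f 0))) (∑<-∑ n xs (f ∘ suc))) (sym (∑-+ xs (f 0) _))

∑∑<-reorder : ∀ (xs : List A) (ys : List B) n m (f : A → ℕ → B → ℕ → ℕ) →
              ∑[ x ← xs ] ∑[ k < n ] ∑[ y ← ys ] ∑[ k′ < m ] f x k y k′ ≡
              ∑[ k < n ] ∑[ k′ < m ] ∑[ x ← xs ] ∑[ y ← ys ] f x k y k′
∑∑<-reorder xs ys n m f = begin
  ∑[ x ← xs ] ∑[ k < n ] ∑[ y ← ys ] ∑[ k′ < m ] f x k y k′
    ≡⟨ ∑-cong xs (λ x → ∑<-cong n (λ k _ → sym (∑<-∑ m ys (λ k′ y → f x k y k′)))) ⟩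
  ∑[ x ← xs ] ∑[ k < n ] ∑[ k′ < m ] ∑[ y ← ys ] f x k y k′
    ≡⟨ ∑<-∑ n xs _ ⟨
  ∑[ k < n ] ∑[ x ← xs ] ∑[ k′ < m ] ∑[ y ← ys ] f x k y k′
    ≡⟨ ∑<-cong n (λ k _ → sym (∑<-∑ m xs (λ k′ x → ∑[ y ← ys ] f x k y k′))) ⟩
  ∑[ k < n ] ∑[ k′ < m ] ∑[ x ← xs ] ∑[ y ← ys ] f x k y k′ ∎
  where open ≡-Reasoning

∑<-δ : ∀ n {k} (f : ℕ → ℕ) → k < n → (∀ {k′} → k′ < n → k ≢ k′ → f k′ ≡ 0) →
       ∑< n f ≡ f k
∑<-δ (suc n) {zero}  f _ f≡0 =
  trans (cong (_+_ (f 0)) (trans (∑<-cong n (λ k′ k′< → f≡0 (s<s k′<) (λ ()))) (∑<-zero n)))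
        (+-identityʳ (f 0))
∑<-δ (suc n) {suc k} f (s<s k<) f≡0 =
  trans (cong (_+ ∑< n (f ∘ suc)) (f≡0 z<s (λ ())))
        (∑<-δ n (f ∘ suc) k< (λ k′< k≢k′ → f≡0 (s<s k′<) (k≢k′ ∘ suc-injective)))

∑<-diagonal : ∀ n (F : ℕ → ℕ → ℕ) →
              (∀ {k k′} → k < n → k′ < n → k ≢ k′ → F k k′ ≡ 0) →
              ∑[ k < n ] ∑[ k′ < n ] F k k′ ≡ ∑[ k < n ] F k k
∑<-diagonal n F off = ∑<-cong n (λ k k< → ∑<-δ n (F k) k< (off k<))

indicator : {P : Set} → Dec P → ℕ
indicator d = if does d then 1 else 0

length-filter-∑ : ∀ {P : Pred A 0ℓ} (P? : Decidable P) xs →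
                  length (filter P? xs) ≡ ∑[ x ← xs ] indicator (P? x)
length-filter-∑ P? []       = refl
length-filter-∑ P? (x ∷ xs) with does (P? x)
... | true  = cong suc (length-filter-∑ P? xs)
... | false = length-filter-∑ P? xs

insertAt : ℕ → A → List A → List A
insertAt k x xs = take k xs ++ x ∷ drop k xs

module _ {A : Set} where

  take-++-≤ : ∀ {k} (xs : List A) {ys} → k ≤ length xs → take k (xs ++ ys) ≡ take k xs
  take-++-≤ {zero}  _        _        = refl
  take-++-≤ {suc k} (x ∷ xs) (s≤s k≤) = cong (x ∷_) (take-++-≤ xs k≤)

  drop-++-≤ : ∀ {k} (xs : List A) {ys} → k ≤ length xs → drop k (xs ++ ys) ≡ drop k xs ++ ys
  drop-++-≤ {zero}  _        _        = refl
  drop-++-≤ {suc k} (x ∷ xs) (s≤s k≤) = drop-++-≤ xs k≤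

  take-suc-length-++ : ∀ (xs : List A) y ys j →
                       take (suc (length xs + j)) (xs ++ y ∷ ys) ≡ xs ++ y ∷ take j ys
  take-suc-length-++ []       y ys j = refl
  take-suc-length-++ (x ∷ xs) y ys j = cong (x ∷_) (take-suc-length-++ xs y ys j)

  drop-suc-length-++ : ∀ (xs : List A) y ys j → drop (suc (length xs + j)) (xs ++ y ∷ ys) ≡ drop j ys
  drop-suc-length-++ []       y ys j = refl
  drop-suc-length-++ (x ∷ xs) y ys j = drop-suc-length-++ xs y ys j

  take-insertAt-≤ : ∀ {k j} (x : A) xs → k ≤ j →
                    take (suc j) (insertAt k x xs) ≡ insertAt k x (take j xs)
  take-insertAt-≤ {zero}          x xs       _        = refl
  take-insertAt-≤ {suc k} {suc j} x []       _        = refl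
  take-insertAt-≤ {suc k} {suc j} x (y ∷ xs) (s≤s k≤) = cong (y ∷_) (take-insertAt-≤ x xs k≤)

  drop-insertAt-≤ : ∀ {k j} (x : A) xs → k ≤ j → drop (suc j) (insertAt k x xs) ≡ drop j xs
  drop-insertAt-≤ {zero}          x xs       _        = refl
  drop-insertAt-≤ {suc k} {suc j} x []       _        = refl
  drop-insertAt-≤ {suc k} {suc j} x (y ∷ xs) (s≤s k≤) = drop-insertAt-≤ x xs k≤

  take-insertAt-+ : ∀ {j} t (x : A) xs → j ≤ length xs → take j (insertAt (j + t) x xs) ≡ take j xs
  take-insertAt-+ {zero}  t x xs       _        = refl
  take-insertAt-+ {suc j} t x (y ∷ xs) (s≤s j≤) = cong (y ∷_) (take-insertAt-+ t x xs j≤)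

  drop-insertAt-+ : ∀ {j} t (x : A) xs → j ≤ length xs →
                    drop j (insertAt (j + t) x xs) ≡ insertAt t x (drop j xs)
  drop-insertAt-+ {zero}  t x xs       _        = refl
  drop-insertAt-+ {suc j} t x (y ∷ xs) (s≤s j≤) = drop-insertAt-+ t x xs j≤

-- Cartesian trees

-- Ties go to the leftmost minimum, as in minIdx.
data IsCT : List ℕ → Tree → Set where
  leaf : IsCT [] leaf
  node : ∀ {l m r A B} → All (m <_) l → All (m ≤_) r → IsCT l A → IsCT r B →
         IsCT (l ++ m ∷ r) (node A B)

LeftmostMinimumAt : List ℕ → ℕ × ℕ → Set
LeftmostMinimumAt s (m , i) =
  s ≡ take i s ++ m ∷ drop (suc i) s × All (m <_) (take i s) × All (m ≤_) (drop (suc i) s)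

minIdx-leftmost : ∀ x xs → LeftmostMinimumAt (x ∷ xs) (minIdx x xs)
minIdx-leftmost x [] = refl , [] , []
minIdx-leftmost x (y ∷ ys) with minIdx y ys | minIdx-leftmost y ys
... | m , i | s≡ , l>m , r≥m with x ≤ᵇ m in x≤ᵇm
... | true  = refl , [] , subst (All (x ≤_)) (sym s≡)
                (++⁺ (All.map (<⇒≤ ∘ ≤-<-trans x≤m) l>m) (x≤m ∷ All.map (≤-trans x≤m) r≥m))
  where
  x≤m : x ≤ m
  x≤m = ≤ᵇ⇒≤ x m (subst T (sym x≤ᵇm) tt)
... | false = cong (x ∷_) s≡ , ≰⇒> (λ x≤m → subst T x≤ᵇm (≤⇒≤ᵇ x≤m)) ∷ l>m , r≥m

leftmostMin-node : ∀ {s m i A B} → LeftmostMinimumAt s (m , i) →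
                   IsCT (take i s) A → IsCT (drop (suc i) s) B → IsCT s (node A B)
leftmostMin-node (s≡ , l>m , r≥m) dl dr = subst (λ s′ → IsCT s′ _) (sym s≡) (node l>m r≥m dl dr)

leftmostMin-shorter : ∀ {s m i} → LeftmostMinimumAt s (m , i) → length s ≤ suc k →
                      length (take i s) ≤ k × length (drop (suc i) s) ≤ k
leftmostMin-shorter {k} {s} {m} {i} (s≡ , _) s≤ =
  ≤-trans (m≤m+n _ _) l+r≤k , ≤-trans (m≤n+m _ _) l+r≤k
  where
  l+r≤k : length (take i s) + length (drop (suc i) s) ≤ k
  l+r≤k = ≤-pred (subst (_≤ suc k) (trans (cong length s≡) (trans (length-++ (take i s)) (+-suc _ _))) s≤)

ctFuel-sound : ∀ k s → length s ≤ k → IsCT s (ctFuel k s)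
ctFuel-sound zero    []       _  = leaf
ctFuel-sound (suc k) []       _  = leaf
ctFuel-sound (suc k) (x ∷ xs) s≤ =
  let l≤k , r≤k = leftmostMin-shorter (minIdx-leftmost x xs) s≤
  in leftmostMin-node (minIdx-leftmost x xs) (ctFuel-sound k _ l≤k) (ctFuel-sound k _ r≤k)

CT-sound : ∀ s → IsCT s (CT s)
CT-sound s = ctFuel-sound (length s) s ≤-refl

leftmostMin-unique : ∀ {l m r l′ m′ r′} → l ++ m ∷ r ≡ l′ ++ m′ ∷ r′ →
                     All (m <_) l → All (m ≤_) r → All (m′ <_) l′ → All (m′ ≤_) r′ →
                     l ≡ l′ × r ≡ r′
leftmostMin-unique {[]}    {l′ = []}     refl _ _ _ _ = refl , refl
leftmostMin-unique {[]}    {l′ = _ ∷ l′} refl _ r≥m (m′<m ∷ _) _ =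
  contradiction (All.head (++⁻ʳ l′ r≥m)) (<⇒≱ m′<m)
leftmostMin-unique {_ ∷ l} {l′ = []}     refl (m<m′ ∷ _) _ _ r′≥m′ =
  contradiction (All.head (++⁻ʳ l r′≥m′)) (<⇒≱ m<m′)
leftmostMin-unique {_ ∷ _} {l′ = _ ∷ _}  eq (_ ∷ l>m) r≥m (_ ∷ l′>m′) r′≥m′ =
  let x≡x′ , tail≡ = ∷-injective eq
      l≡l′ , r≡r′ = leftmostMin-unique tail≡ l>m r≥m l′>m′ r′≥m′
  in cong₂ _∷_ x≡x′ l≡l′ , r≡r′

IsCT-functional : ∀ {s s′} → IsCT s t → IsCT s′ u → s ≡ s′ → t ≡ u
IsCT-functional leaf leaf _ = refl
IsCT-functional leaf (node {l} _ _ _ _) []≡ with () ← ++-conicalʳ l _ (sym []≡)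
IsCT-functional (node {l} _ _ _ _) leaf ≡[] with () ← ++-conicalʳ l _ ≡[]
IsCT-functional (node l>m r≥m dl dr) (node l′>m′ r′≥m′ dl′ dr′) eq =
  let l≡l′ , r≡r′ = leftmostMin-unique eq l>m r≥m l′>m′ r′≥m′
  in cong₂ node (IsCT-functional dl dl′ l≡l′) (IsCT-functional dr dr′ r≡r′)

CT-unique : ∀ {s} → IsCT s t → CT s ≡ t
CT-unique {s = s} d = IsCT-functional (CT-sound s) d refl

CT-++-∷ : ∀ {l m r} → All (m <_) l → All (m ≤_) r → CT (l ++ m ∷ r) ≡ node (CT l) (CT r)
CT-++-∷ {l} {m} {r} l>m r≥m = CT-unique (node l>m r≥m (CT-sound l) (CT-sound r))

module _ {f : ℕ → ℕ} (f-mono : f Preserves _<_ ⟶ _<_) where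

  private
    f-mono-≤ : f Preserves _≤_ ⟶ _≤_
    f-mono-≤ x≤y with m≤n⇒m<n∨m≡n x≤y
    ... | inj₁ x<y  = <⇒≤ (f-mono x<y)
    ... | inj₂ refl = ≤-refl

  IsCT-map : ∀ {s} → IsCT s t → IsCT (map f s) t
  IsCT-map leaf = leaf
  IsCT-map (node {l} {m} {r} l>m r≥m dl dr) =
    subst (λ s → IsCT s _) (sym (map-++ f l (m ∷ r)))
      (node (map⁺ (All.map f-mono l>m)) (map⁺ (All.map f-mono-≤ r≥m)) (IsCT-map dl) (IsCT-map dr))

  CT-map : ∀ s → CT (map f s) ≡ CT s
  CT-map s = CT-unique (IsCT-map (CT-sound s))

size : Tree → ℕ
size leaf       = 0
size (node A B) = suc (size A + size B)

IsCT-size : ∀ {s} → IsCT s t → size t ≡ length s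
IsCT-size leaf = refl
IsCT-size (node {l} _ _ dl dr) =
  trans (cong suc (cong₂ _+_ (IsCT-size dl) (IsCT-size dr))) (sym (trans (length-++ l) (+-suc _ _)))

size-CT-take : ∀ s → k ≤ length s → size (CT (take k s)) ≡ k
size-CT-take {k} s k≤ = trans (IsCT-size (CT-sound (take k s))) (trans (length-take k s) (m≤n⇒m⊓n≡m k≤))

split : ℕ → Tree → Tree × Tree
split k leaf = leaf , leaf
split k (node A B) with k ≤? size A
... | yes _ = Product.map₂ (λ A₂ → node A₂ B) (split k A)
... | no  _ = Product.map₁ (node A) (split (k ∸ suc (size A)) B)

split-node-≤ : ∀ {A B} → k ≤ size A →
               split k (node A B) ≡ Product.map₂ (λ A₂ → node A₂ B) (split k A)
split-node-≤ {k} {A} k≤ with k ≤? size A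
... | yes _  = refl
... | no  k≰ = contradiction k≤ k≰

split-node-> : ∀ {A B} → size A ≡ n → split (suc (n + j)) (node A B) ≡ Product.map₁ (node A) (split j B)
split-node-> {n} {j} {A} {B} refl with suc (size A + j) ≤? size A
... | yes k≤ = contradiction k≤ (m+n≮m (size A) j)
... | no  _  = cong (λ i → Product.map₁ (node A) (split i B)) (m+n∸m≡n (size A) j)

≤⊎≡suc+ : ∀ k n → k ≤ n ⊎ ∃ λ j → k ≡ suc (n + j)
≤⊎≡suc+ zero    n       = inj₁ z≤n
≤⊎≡suc+ (suc k) zero    = inj₂ (k , refl)
≤⊎≡suc+ (suc k) (suc n) = Sum.map s≤s (Product.map₂ (cong suc)) (≤⊎≡suc+ k n)

IsCT-split : ∀ k {s} → IsCT s t →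
             IsCT (take k s) (proj₁ (split k t)) × IsCT (drop k s) (proj₂ (split k t))
IsCT-split zero    leaf = leaf , leaf
IsCT-split (suc k) leaf = leaf , leaf
IsCT-split k (node {l} {m} {r} {A} {B} l>m r≥m dl dr) with ≤⊎≡suc+ k (length l)
... | inj₁ k≤ rewrite take-++-≤ l {m ∷ r} k≤ | drop-++-≤ l {m ∷ r} k≤ =
  subst (λ p → IsCT _ (proj₁ p) × IsCT _ (proj₂ p))
    (sym (split-node-≤ {B = B} (subst (k ≤_) (sym (IsCT-size dl)) k≤)))
    (let dl₁ , dl₂ = IsCT-split k dl in dl₁ , node (drop⁺ k l>m) r≥m dl₂ dr)
... | inj₂ (j , refl) rewrite take-suc-length-++ l m r j | drop-suc-length-++ l m r j =
  subst (λ p → IsCT _ (proj₁ p) × IsCT _ (proj₂ p))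
    (sym (split-node-> {B = B} (IsCT-size dl)))
    (let dr₁ , dr₂ = IsCT-split j dr in node l>m (take⁺ j r≥m) dl dr₁ , dr₂)

CT-split : ∀ k s → split k (CT s) ≡ (CT (take k s) , CT (drop k s))
CT-split k s =
  let d₁ , d₂ = IsCT-split k (CT-sound s)
  in sym (cong₂ _,_ (CT-unique d₁) (CT-unique d₂))

insertMin : ℕ → List ℕ → List ℕ
insertMin k s = insertAt k 0 (map suc s)

insertRoot : ℕ → Tree → Tree
insertRoot k t = uncurry node (split k t)

insertRoot-CT : ∀ k s → insertRoot k (CT s) ≡ node (CT (take k s)) (CT (drop k s))
insertRoot-CT k s = cong (uncurry node) (CT-split k s)

CT-insertMin : ∀ k s → CT (insertMin k s) ≡ insertRoot k (CT s)
CT-insertMin k s = begin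
  CT (take k (map suc s) ++ 0 ∷ drop k (map suc s))
    ≡⟨ CT-++-∷ (take⁺ k (map⁺ (All.universal (λ _ → z<s) s))) (All.universal (λ _ → z≤n) _) ⟩
  node (CT (take k (map suc s))) (CT (drop k (map suc s)))
    ≡⟨ cong₂ node (cong CT (take-map k s)) (cong CT (drop-map k s)) ⟩
  node (CT (map suc (take k s))) (CT (map suc (drop k s)))
    ≡⟨ cong₂ node (CT-map s<s (take k s)) (CT-map s<s (drop k s)) ⟩
  node (CT (take k s)) (CT (drop k s))
    ≡⟨ insertRoot-CT k s ⟨
  insertRoot k (CT s) ∎
  where open ≡-Reasoning

CT-take-insertMin-≤ : ∀ s → k ≤ j → CT (take (suc j) (insertMin k s)) ≡ insertRoot k (CT (take j s))
CT-take-insertMin-≤ {k} {j} s k≤j = begin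
  CT (take (suc j) (insertMin k s))      ≡⟨ cong CT (take-insertAt-≤ 0 (map suc s) k≤j) ⟩
  CT (insertAt k 0 (take j (map suc s))) ≡⟨ cong (CT ∘ insertAt k 0) (take-map j s) ⟩
  CT (insertMin k (take j s))            ≡⟨ CT-insertMin k (take j s) ⟩
  insertRoot k (CT (take j s))           ∎
  where open ≡-Reasoning

CT-drop-insertMin-≤ : ∀ s → k ≤ j → CT (drop (suc j) (insertMin k s)) ≡ CT (drop j s)
CT-drop-insertMin-≤ {k} {j} s k≤j = begin
  CT (drop (suc j) (insertMin k s)) ≡⟨ cong CT (drop-insertAt-≤ 0 (map suc s) k≤j) ⟩
  CT (drop j (map suc s))           ≡⟨ cong CT (drop-map j s) ⟩
  CT (map suc (drop j s))           ≡⟨ CT-map s<s (drop j s) ⟩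
  CT (drop j s)                     ∎
  where open ≡-Reasoning

CT-take-insertMin-+ : ∀ s t → j ≤ length s → CT (take j (insertMin (j + t) s)) ≡ CT (take j s)
CT-take-insertMin-+ {j} s t j≤ = begin
  CT (take j (insertMin (j + t) s))
    ≡⟨ cong CT (take-insertAt-+ t 0 (map suc s) (subst (j ≤_) (sym (length-map suc s)) j≤)) ⟩
  CT (take j (map suc s)) ≡⟨ cong CT (take-map j s) ⟩
  CT (map suc (take j s)) ≡⟨ CT-map s<s (take j s) ⟩
  CT (take j s)           ∎
  where open ≡-Reasoning

CT-drop-insertMin-+ : ∀ s t → j ≤ length s →
                      CT (drop j (insertMin (j + t) s)) ≡ insertRoot t (CT (drop j s))
CT-drop-insertMin-+ {j} s t j≤ = begin
  CT (drop j (insertMin (j + t) s))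
    ≡⟨ cong CT (drop-insertAt-+ t 0 (map suc s) (subst (j ≤_) (sym (length-map suc s)) j≤)) ⟩
  CT (insertAt t 0 (drop j (map suc s))) ≡⟨ cong (CT ∘ insertAt t 0) (drop-map j s) ⟩
  CT (insertMin t (drop j s))            ≡⟨ CT-insertMin t (drop j s) ⟩
  insertRoot t (CT (drop j s))           ∎
  where open ≡-Reasoning

-- Permutations

∑-insertions : ∀ x ys (f : List ℕ → ℕ) →
               ∑ (insertions x ys) f ≡ ∑[ k < suc (length ys) ] f (insertAt k x ys)
∑-insertions x []       f = refl
∑-insertions x (y ∷ ys) f =
  cong (_+_ (f (x ∷ y ∷ ys)))
       (trans (∑-map (y ∷_) (insertions x ys) f) (∑-insertions x ys (f ∘ (y ∷_))))

insertions-length : ∀ x ys → All (λ σ → length σ ≡ suc (length ys)) (insertions x ys)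
insertions-length x []       = refl ∷ []
insertions-length x (y ∷ ys) = refl ∷ map⁺ (All.map (cong suc) (insertions-length x ys))

permsOf-length : ∀ xs → All (λ σ → length σ ≡ length xs) (permsOf xs)
permsOf-length []       = refl ∷ []
permsOf-length (x ∷ xs) = concat⁺ (map⁺ (All.map
  (λ {ρ} len → All.map (λ len′ → trans len′ (cong suc len)) (insertions-length x ρ)) (permsOf-length xs)))

perms-length : ∀ n → All (λ σ → length σ ≡ n) (perms n)
perms-length n = All.map (λ len → trans len (length-upTo n)) (permsOf-length (upTo n))

∑-perms-cong : ∀ n {f g} → (∀ σ → length σ ≡ n → f σ ≡ g σ) → ∑ (perms n) f ≡ ∑ (perms n) g
∑-perms-cong n f≗g = ∑-congᴬ (All.map (λ {σ} → f≗g σ) (perms-length n))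

insertions-map : ∀ (f : ℕ → ℕ) x ys → insertions (f x) (map f ys) ≡ map (map f) (insertions x ys)
insertions-map f x []       = refl
insertions-map f x (y ∷ ys) = cong ((f x ∷ f y ∷ map f ys) ∷_) (begin
  map (f y ∷_) (insertions (f x) (map f ys))   ≡⟨ cong (map (f y ∷_)) (insertions-map f x ys) ⟩
  map (f y ∷_) (map (map f) (insertions x ys)) ≡⟨ map-∘ (insertions x ys) ⟨
  map (map f ∘ (y ∷_)) (insertions x ys)       ≡⟨ map-∘ (insertions x ys) ⟩
  map (map f) (map (y ∷_) (insertions x ys))   ∎)
  where open ≡-Reasoning

permsOf-map : ∀ (f : ℕ → ℕ) xs → permsOf (map f xs) ≡ map (map f) (permsOf xs)
permsOf-map f []       = refl
permsOf-map f (x ∷ xs) = begin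
  concatMap (insertions (f x)) (permsOf (map f xs))       ≡⟨ cong (concatMap _) (permsOf-map f xs) ⟩
  concatMap (insertions (f x)) (map (map f) (permsOf xs)) ≡⟨ concatMap-map _ (map f) (permsOf xs) ⟩
  concatMap (insertions (f x) ∘ map f) (permsOf xs)       ≡⟨ concatMap-cong (insertions-map f x) (permsOf xs) ⟩
  concatMap (map (map f) ∘ insertions x) (permsOf xs)     ≡⟨ map-concatMap (map f) (insertions x) (permsOf xs) ⟨
  map (map f) (concatMap (insertions x) (permsOf xs))     ∎
  where open ≡-Reasoning

perms-suc : ∀ n → perms (suc n) ≡ concatMap (insertions 0) (map (map suc) (perms n))
perms-suc n =
  cong (concatMap (insertions 0)) (trans (cong permsOf (sym (map-applyUpTo id suc n))) (permsOf-map suc (upTo n)))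

∑-perms-suc : ∀ n f → ∑ (perms (suc n)) f ≡ ∑[ ρ ← perms n ] ∑[ k < suc n ] f (insertMin k ρ)
∑-perms-suc n f = begin
  ∑ (perms (suc n)) f
    ≡⟨ cong (λ P → ∑ P f) (perms-suc n) ⟩
  ∑ (concatMap (insertions 0) (map (map suc) (perms n))) f
    ≡⟨ ∑-concatMap (insertions 0) (map (map suc) (perms n)) f ⟩
  ∑[ π ← map (map suc) (perms n) ] ∑ (insertions 0 π) f
    ≡⟨ ∑-map (map suc) (perms n) _ ⟩
  ∑[ ρ ← perms n ] ∑ (insertions 0 (map suc ρ)) f
    ≡⟨ ∑-perms-cong n (λ ρ len → trans (∑-insertions 0 (map suc ρ) f)
         (cong (λ m → ∑[ k < suc m ] f (insertMin k ρ)) (trans (length-map suc ρ) len))) ⟩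
  ∑[ ρ ← perms n ] ∑[ k < suc n ] f (insertMin k ρ) ∎
  where open ≡-Reasoning

∑CT : ℕ → (Tree → ℕ) → ℕ
∑CT n g = ∑[ σ ← perms n ] g (CT σ)

∑CT-suc : ∀ n g → ∑CT (suc n) g ≡ ∑[ ρ ← perms n ] ∑[ k < suc n ] g (insertRoot k (CT ρ))
∑CT-suc n g =
  trans (∑-perms-suc n (g ∘ CT))
        (∑-cong (perms n) (λ ρ → ∑<-cong (suc n) (λ k _ → cong g (CT-insertMin k ρ))))

SplitSum : ℕ → ℕ → Set
SplitSum n j = ∀ (f : Tree → Tree → ℕ) →
  ∑[ s ← perms n ] f (CT (take j s)) (CT (drop j s)) ≡ (n C j) * ∑CT j (λ A → ∑CT (n ∸ j) (f A))

∑-perms-split-left : ∀ {n j} → SplitSum n j → ∀ f →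
  ∑[ ρ ← perms n ] ∑[ k < suc j ] f (CT (take (suc j) (insertMin k ρ))) (CT (drop (suc j) (insertMin k ρ)))
  ≡ (n C j) * ∑CT (suc j) (λ A → ∑CT (n ∸ j) (f A))
∑-perms-split-left {n} {j} ih f = begin
  ∑[ ρ ← perms n ] ∑[ k < suc j ] f (CT (take (suc j) (insertMin k ρ))) (CT (drop (suc j) (insertMin k ρ)))
    ≡⟨ ∑-cong (perms n) (λ ρ → ∑<-cong (suc j) (λ k k< →
         cong₂ f (CT-take-insertMin-≤ ρ (≤-pred k<)) (CT-drop-insertMin-≤ ρ (≤-pred k<)))) ⟩
  ∑[ ρ ← perms n ] ∑[ k < suc j ] f (insertRoot k (CT (take j ρ))) (CT (drop j ρ))
    ≡⟨ ih (λ A B → ∑[ k < suc j ] f (insertRoot k A) B) ⟩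
  (n C j) * ∑CT j (λ A → ∑CT (n ∸ j) (λ B → ∑[ k < suc j ] f (insertRoot k A) B))
    ≡⟨ cong ((n C j) *_) (∑-cong (perms j) (λ α →
         sym (∑<-∑ (suc j) (perms (n ∸ j)) (λ k β → f (insertRoot k (CT α)) (CT β))))) ⟩
  (n C j) * ∑[ α ← perms j ] ∑[ k < suc j ] ∑CT (n ∸ j) (f (insertRoot k (CT α)))
    ≡⟨ cong ((n C j) *_) (∑CT-suc j (λ A → ∑CT (n ∸ j) (f A))) ⟨
  (n C j) * ∑CT (suc j) (λ A → ∑CT (n ∸ j) (f A)) ∎
  where open ≡-Reasoning

∑-perms-split-right : ∀ {n j} → j ≤ n → (j < n → SplitSum n (suc j)) → ∀ f →
  ∑[ ρ ← perms n ] ∑[ t < n ∸ j ] f (CT (take (suc j) (insertMin (suc j + t) ρ)))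
                                     (CT (drop (suc j) (insertMin (suc j + t) ρ)))
  ≡ (n C suc j) * ∑CT (suc j) (λ A → ∑CT (n ∸ j) (f A))
∑-perms-split-right {n} {j} j≤n ih f with m≤n⇒m<n∨m≡n j≤n
... | inj₂ refl rewrite n∸n≡0 n | k>n⇒nCk≡0 (n<1+n n) = ∑-zero (perms n)
... | inj₁ j<n rewrite +-∸-assoc 1 j<n = begin
  ∑[ ρ ← perms n ] ∑[ t < suc i ] f (CT (take (suc j) (insertMin (suc j + t) ρ)))
                                    (CT (drop (suc j) (insertMin (suc j + t) ρ)))
    ≡⟨ ∑-perms-cong n (λ ρ len → ∑<-cong (suc i) (λ t _ →
         let j<ρ = subst (suc j ≤_) (sym len) j<n
         in cong₂ f (CT-take-insertMin-+ ρ t j<ρ) (CT-drop-insertMin-+ ρ t j<ρ))) ⟩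
  ∑[ ρ ← perms n ] ∑[ t < suc i ] f (CT (take (suc j) ρ)) (insertRoot t (CT (drop (suc j) ρ)))
    ≡⟨ ih j<n (λ A B → ∑[ t < suc i ] f A (insertRoot t B)) ⟩
  (n C suc j) * ∑CT (suc j) (λ A → ∑CT i (λ B → ∑[ t < suc i ] f A (insertRoot t B)))
    ≡⟨ cong ((n C suc j) *_) (∑-cong (perms (suc j)) (λ α → ∑CT-suc i (f (CT α)))) ⟨
  (n C suc j) * ∑CT (suc j) (λ A → ∑CT (suc i) (f A)) ∎
  where
  open ≡-Reasoning
  i = n ∸ suc j

∑-perms-split : ∀ {n j} → j ≤ n → SplitSum n j
∑-perms-split {n}     {zero}  _         f = sym (trans (+-identityʳ _) (+-identityʳ _))
∑-perms-split {suc n} {suc j} (s≤s j≤n) f = begin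
  ∑[ s ← perms (suc n) ] F s
    ≡⟨ ∑-perms-suc n F ⟩
  ∑[ ρ ← perms n ] ∑[ k < suc n ] F (insertMin k ρ)
    ≡⟨ ∑-cong (perms n) (λ ρ →
         trans (cong (λ m → ∑[ k < m ] F (insertMin k ρ)) (cong suc (sym (m+[n∸m]≡n j≤n))))
               (∑<-+ (suc j) (n ∸ j) (λ k → F (insertMin k ρ)))) ⟩
  ∑[ ρ ← perms n ] (∑[ k < suc j ] F (insertMin k ρ) + ∑[ t < n ∸ j ] F (insertMin (suc j + t) ρ))
    ≡⟨ ∑-+ (perms n) _ _ ⟩
  ∑[ ρ ← perms n ] ∑[ k < suc j ] F (insertMin k ρ)
    + ∑[ ρ ← perms n ] ∑[ t < n ∸ j ] F (insertMin (suc j + t) ρ)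
    ≡⟨ cong₂ _+_ (∑-perms-split-left {n} {j} (∑-perms-split j≤n) f)
                 (∑-perms-split-right j≤n ∑-perms-split f) ⟩
  (n C j) * X + (n C suc j) * X
    ≡⟨ *-distribʳ-+ X (n C j) (n C suc j) ⟨
  (n C j + n C suc j) * X
    ≡⟨ cong (_* X) (nCk+nC[k+1]≡[n+1]C[k+1] n j) ⟩
  (suc n C suc j) * X ∎
  where
  open ≡-Reasoning
  F : List ℕ → ℕ
  F s = f (CT (take (suc j) s)) (CT (drop (suc j) s))
  X : ℕ
  X = ∑CT (suc j) (λ A → ∑CT (n ∸ j) (f A))

-- Pairs with the same Cartesian tree

sameTree : Tree → Tree → ℕ
sameTree A B = indicator (A ≟T B)

sameTree-node : ∀ A B A′ B′ → sameTree (node A B) (node A′ B′) ≡ sameTree A A′ * sameTree B B′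
sameTree-node A B A′ B′ with A ≟T A′ | B ≟T B′
... | yes refl | yes refl = refl
... | yes refl | no  _    = refl
... | no  _    | yes _    = refl
... | no  _    | no  _    = refl

sameTree-size : ∀ A B → size A ≢ size B → sameTree A B ≡ 0
sameTree-size A B size≢ with A ≟T B
... | yes refl = contradiction refl size≢
... | no  _    = refl

sameCTCount-∑CT : ∀ n → sameCTCount n ≡ ∑CT n (λ A → ∑CT n (sameTree A))
sameCTCount-∑CT n =
  trans (length-filter-∑ _ (cartesianProduct (perms n) (perms n))) (∑-cartesianProduct (perms n) (perms n) _)

sameTree-insertRoot : ∀ k k′ ρ ρ′ →
  sameTree (insertRoot k (CT ρ)) (insertRoot k′ (CT ρ′))
  ≡ sameTree (CT (take k ρ)) (CT (take k′ ρ′)) * sameTree (CT (drop k ρ)) (CT (drop k′ ρ′))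
sameTree-insertRoot k k′ ρ ρ′ =
  trans (cong₂ sameTree (insertRoot-CT k ρ) (insertRoot-CT k′ ρ′))
        (sameTree-node (CT (take k ρ)) (CT (drop k ρ)) (CT (take k′ ρ′)) (CT (drop k′ ρ′)))

∑-sameTree-insertRoot-≢ : ∀ {n k k′} → k ≢ k′ → k ≤ n → k′ ≤ n →
  ∑[ ρ ← perms n ] ∑[ ρ′ ← perms n ] sameTree (insertRoot k (CT ρ)) (insertRoot k′ (CT ρ′)) ≡ 0
∑-sameTree-insertRoot-≢ {n} {k} {k′} k≢k′ k≤n k′≤n =
  trans (∑-perms-cong n (λ ρ len →
           trans (∑-perms-cong n (λ ρ′ len′ → term≡0 ρ ρ′ len len′)) (∑-zero (perms n))))
        (∑-zero (perms n))
  where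
  term≡0 : ∀ ρ ρ′ → length ρ ≡ n → length ρ′ ≡ n →
           sameTree (insertRoot k (CT ρ)) (insertRoot k′ (CT ρ′)) ≡ 0
  term≡0 ρ ρ′ len len′ =
    trans (sameTree-insertRoot k k′ ρ ρ′)
          (cong (_* sameTree (CT (drop k ρ)) (CT (drop k′ ρ′))) (sameTree-size _ _ size≢))
    where
    size≢ : size (CT (take k ρ)) ≢ size (CT (take k′ ρ′))
    size≢ size≡ = k≢k′ (trans (sym (size-CT-take ρ (subst (k ≤_) (sym len) k≤n)))
                              (trans size≡ (size-CT-take ρ′ (subst (k′ ≤_) (sym len′) k′≤n))))

∑-sameTree-insertRoot : ∀ {n k} → k ≤ n →
  ∑[ ρ ← perms n ] ∑[ ρ′ ← perms n ] sameTree (insertRoot k (CT ρ)) (insertRoot k (CT ρ′))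
  ≡ (n C k) * ((n C k) * (sameCTCount k * sameCTCount (n ∸ k)))
∑-sameTree-insertRoot {n} {k} k≤n = begin
  ∑[ ρ ← perms n ] ∑[ ρ′ ← perms n ] sameTree (insertRoot k (CT ρ)) (insertRoot k (CT ρ′))
    ≡⟨ ∑-cong (perms n) (λ ρ → ∑-cong (perms n) (sameTree-insertRoot k k ρ)) ⟩
  ∑[ ρ ← perms n ] ∑[ ρ′ ← perms n ]
    sameSides (CT (take k ρ)) (CT (drop k ρ)) (CT (take k ρ′)) (CT (drop k ρ′))
    ≡⟨ ∑-cong (perms n) (λ ρ → ∑-perms-split k≤n (sameSides (CT (take k ρ)) (CT (drop k ρ)))) ⟩
  ∑[ ρ ← perms n ] ((n C k) * matches (CT (take k ρ)) (CT (drop k ρ)))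
    ≡⟨ ∑-*ˡ (perms n) (n C k) _ ⟩
  (n C k) * ∑[ ρ ← perms n ] matches (CT (take k ρ)) (CT (drop k ρ))
    ≡⟨ cong ((n C k) *_) (∑-perms-split k≤n matches) ⟩
  (n C k) * ((n C k) * ∑CT k (λ A → ∑CT (n ∸ k) (matches A)))
    ≡⟨ cong (λ x → (n C k) * ((n C k) * x)) (∑∑-*-∑∑ (perms k) (perms k) (perms (n ∸ k)) (perms (n ∸ k))
         (λ α α′ → sameTree (CT α) (CT α′)) (λ β β′ → sameTree (CT β) (CT β′))) ⟨
  (n C k) * ((n C k) * (∑CT k (λ A → ∑CT k (sameTree A)) * ∑CT (n ∸ k) (λ B → ∑CT (n ∸ k) (sameTree B))))
    ≡⟨ cong₂ (λ x y → (n C k) * ((n C k) * (x * y))) (sameCTCount-∑CT k) (sameCTCount-∑CT (n ∸ k)) ⟨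
  (n C k) * ((n C k) * (sameCTCount k * sameCTCount (n ∸ k))) ∎
  where
  open ≡-Reasoning
  sameSides : Tree → Tree → Tree → Tree → ℕ
  sameSides A B A′ B′ = sameTree A A′ * sameTree B B′
  matches : Tree → Tree → ℕ
  matches A B = ∑CT k (λ A′ → ∑CT (n ∸ k) (sameSides A B A′))

sameCTCount-suc : ∀ n →
  sameCTCount (suc n) ≡ ∑[ k < suc n ] ((n C k) * ((n C k) * (sameCTCount k * sameCTCount (n ∸ k))))
sameCTCount-suc n = begin
  sameCTCount (suc n)
    ≡⟨ sameCTCount-∑CT (suc n) ⟩
  ∑CT (suc n) (λ A → ∑CT (suc n) (sameTree A))
    ≡⟨ ∑CT-suc n (λ A → ∑CT (suc n) (sameTree A)) ⟩
  ∑[ ρ ← perms n ] ∑[ k < suc n ] ∑CT (suc n) (sameTree (insertRoot k (CT ρ)))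
    ≡⟨ ∑-cong (perms n) (λ ρ → ∑<-cong (suc n) (λ k _ → ∑CT-suc n (sameTree (insertRoot k (CT ρ))))) ⟩
  ∑[ ρ ← perms n ] ∑[ k < suc n ] ∑[ ρ′ ← perms n ] ∑[ k′ < suc n ] same ρ k ρ′ k′
    ≡⟨ ∑∑<-reorder (perms n) (perms n) (suc n) (suc n) same ⟩
  ∑[ k < suc n ] ∑[ k′ < suc n ] ∑[ ρ ← perms n ] ∑[ ρ′ ← perms n ] same ρ k ρ′ k′
    ≡⟨ ∑<-diagonal (suc n) _ (λ k< k′< k≢k′ →
         ∑-sameTree-insertRoot-≢ k≢k′ (≤-pred k<) (≤-pred k′<)) ⟩
  ∑[ k < suc n ] ∑[ ρ ← perms n ] ∑[ ρ′ ← perms n ] same ρ k ρ′ k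
    ≡⟨ ∑<-cong (suc n) (λ k k< → ∑-sameTree-insertRoot (≤-pred k<)) ⟩
  ∑[ k < suc n ] ((n C k) * ((n C k) * (sameCTCount k * sameCTCount (n ∸ k)))) ∎
  where
  open ≡-Reasoning
  same : List ℕ → ℕ → List ℕ → ℕ → ℕ
  same ρ k ρ′ k′ = sameTree (insertRoot k (CT ρ)) (insertRoot k′ (CT ρ′))

-- Fractions

fromℚᵘ-homo-* : ∀ x y → fromℚᵘ (x ℚᵘ.* y) ≡ fromℚᵘ x *ℚ fromℚᵘ y
fromℚᵘ-homo-* x y = toℚᵘ-injective (begin
  toℚᵘ (fromℚᵘ (x ℚᵘ.* y))            ≈⟨ toℚᵘ-fromℚᵘ (x ℚᵘ.* y) ⟩
  x ℚᵘ.* y                            ≈⟨ ℚᵘ.*-cong (toℚᵘ-fromℚᵘ x) (toℚᵘ-fromℚᵘ y) ⟨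
  toℚᵘ (fromℚᵘ x) ℚᵘ.* toℚᵘ (fromℚᵘ y) ≈⟨ toℚᵘ-homo-* (fromℚᵘ x) (fromℚᵘ y) ⟨
  toℚᵘ (fromℚᵘ x *ℚ fromℚᵘ y)         ∎)
  where open ℚᵘ.≃-Reasoning

fromℚᵘ-homo-+ : ∀ x y → fromℚᵘ (x ℚᵘ.+ y) ≡ fromℚᵘ x +ℚ fromℚᵘ y
fromℚᵘ-homo-+ x y = toℚᵘ-injective (begin
  toℚᵘ (fromℚᵘ (x ℚᵘ.+ y))            ≈⟨ toℚᵘ-fromℚᵘ (x ℚᵘ.+ y) ⟩
  x ℚᵘ.+ y                            ≈⟨ ℚᵘ.+-cong (toℚᵘ-fromℚᵘ x) (toℚᵘ-fromℚᵘ y) ⟨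
  toℚᵘ (fromℚᵘ x) ℚᵘ.+ toℚᵘ (fromℚᵘ y) ≈⟨ toℚᵘ-homo-+ (fromℚᵘ x) (fromℚᵘ y) ⟨
  toℚᵘ (fromℚᵘ x +ℚ fromℚᵘ y)         ∎)
  where open ℚᵘ.≃-Reasoning

+a/b≡+c/d : ∀ a b c d .{{_ : NonZero b}} .{{_ : NonZero d}} → a * d ≡ c * b → + a / b ≡ + c / d
+a/b≡+c/d a (suc b) c (suc d) ad≡cb = fromℚᵘ-cong {mkℚᵘ (+ a) b} {mkℚᵘ (+ c) d}
  (*≡* (trans (sym (pos-* a (suc d))) (trans (cong +_ ad≡cb) (pos-* c (suc b)))))

+a/b*+c/d≡+ac/bd : ∀ a b c d .{{_ : NonZero b}} .{{_ : NonZero d}} →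
                   (+ a / b) *ℚ (+ c / d) ≡ (+ (a * c) / (b * d)) {{m*n≢0 b d}}
+a/b*+c/d≡+ac/bd a (suc b) c (suc d) =
  trans (sym (fromℚᵘ-homo-* (mkℚᵘ (+ a) b) (mkℚᵘ (+ c) d))) (/-cong (sym (pos-* a c)) refl)

+a/b++c/d≡+[ad+cb]/bd : ∀ a b c d .{{_ : NonZero b}} .{{_ : NonZero d}} →
                        (+ a / b) +ℚ (+ c / d) ≡ (+ (a * d + c * b) / (b * d)) {{m*n≢0 b d}}
+a/b++c/d≡+[ad+cb]/bd a (suc b) c (suc d) =
  trans (sym (fromℚᵘ-homo-+ (mkℚᵘ (+ a) b) (mkℚᵘ (+ c) d)))
        (/-cong (trans (cong₂ ℤ._+_ (sym (pos-* a (suc d))) (sym (pos-* c (suc b))))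
                       (sym (pos-+ (a * suc d) (c * suc b))))
                refl)

foldr-+-fractions : ∀ N (g : ℕ → ℚ) (c : ℕ → ℕ) {D} .{{_ : NonZero D}} →
                    (∀ i → i < N → g i ≡ + c i / D) →
                    foldr _+ℚ_ 0ℚ (applyUpTo g N) ≡ + ∑< N c / D
foldr-+-fractions zero    g c {D} _   = sym (0/n≡0 D)
foldr-+-fractions (suc N) g c {D} g≡c = begin
  g 0 +ℚ foldr _+ℚ_ 0ℚ (applyUpTo (g ∘ suc) N)
    ≡⟨ cong₂ _+ℚ_ (g≡c 0 z<s)
                  (foldr-+-fractions N (g ∘ suc) (c ∘ suc) (λ i i< → g≡c (suc i) (s<s i<))) ⟩
  + c 0 / D +ℚ + ∑< N (c ∘ suc) / D
    ≡⟨ +a/b++c/d≡+[ad+cb]/bd (c 0) D (∑< N (c ∘ suc)) D ⟩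
  + (c 0 * D + ∑< N (c ∘ suc) * D) / (D * D)
    ≡⟨ +a/b≡+c/d (c 0 * D + ∑< N (c ∘ suc) * D) (D * D) (∑< (suc N) c) D
         (solve 3 (λ a s d → (a :* d :+ s :* d) :* d := (a :+ s) :* (d :* d)) refl (c 0) (∑< N (c ∘ suc)) D) ⟩
  + ∑< (suc N) c / D ∎
  where
  open ≡-Reasoning
  instance _ = m*n≢0 D D

nCk*k![n∸k]!≡n! : k ≤ n → (n C k) * (k ! * (n ∸ k) !) ≡ n !
nCk*k![n∸k]!≡n! {k} {n} k≤n =
  trans (cong (_* (k ! * (n ∸ k) !)) (nCk≡n!/k![n-k]! k≤n))
        (m/n*n≡m {{k !* (n ∸ k) !≢0}} (k![n∸k]!∣n! k≤n))

p[i]*p[n∸i] : ∀ {n i} → i ≤ n →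
  p i *ℚ p (n ∸ i)
  ≡ (+ ((n C i) * ((n C i) * (sameCTCount i * sameCTCount (n ∸ i)))) / (n ! * n !)) {{n !* n !≢0}}
p[i]*p[n∸i] {n} {i} i≤n = begin
  p i *ℚ p m
    ≡⟨ +a/b*+c/d≡+ac/bd (S i) (i ! * i !) (S m) (m ! * m !) ⟩
  + (S i * S m) / ((i ! * i !) * (m ! * m !))
    ≡⟨ +a/b≡+c/d (S i * S m) ((i ! * i !) * (m ! * m !)) (c * (c * (S i * S m))) (n ! * n !) cross ⟩
  + (c * (c * (S i * S m))) / (n ! * n !) ∎
  where
  open ≡-Reasoning
  m = n ∸ i
  c = n C i
  S = sameCTCount
  instance
    _ = i !* i !≢0
    _ = m !* m !≢0
    _ = n !* n !≢0
    _ = m*n≢0 (i ! * i !) (m ! * m !)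
  cross : S i * S m * (n ! * n !) ≡ c * (c * (S i * S m)) * ((i ! * i !) * (m ! * m !))
  cross = trans (cong (λ f → S i * S m * (f * f)) (sym (nCk*k![n∸k]!≡n! i≤n)))
    (solve 5 (λ a b c x y → a :* b :* ((c :* (x :* y)) :* (c :* (x :* y)))
                          := c :* (c :* (a :* b)) :* ((x :* x) :* (y :* y)))
       refl (S i) (S m) c (i !) (m !))

convSum-suc : ∀ n → convSum (suc n) ≡ (+ sameCTCount (suc n) / (n ! * n !)) {{n !* n !≢0}}
convSum-suc n = begin
  convSum (suc n)
    ≡⟨ cong (foldr _+ℚ_ 0ℚ) (map-applyUpTo id (λ i → p i *ℚ p (n ∸ i)) (suc n)) ⟩
  foldr _+ℚ_ 0ℚ (applyUpTo (λ i → p i *ℚ p (n ∸ i)) (suc n))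
    ≡⟨ foldr-+-fractions (suc n) (λ i → p i *ℚ p (n ∸ i)) c (λ i i< → p[i]*p[n∸i] (≤-pred i<)) ⟩
  + ∑< (suc n) c / (n ! * n !)
    ≡⟨ cong (λ x → + x / (n ! * n !)) (sameCTCount-suc n) ⟨
  + sameCTCount (suc n) / (n ! * n !) ∎
  where
  open ≡-Reasoning
  instance _ = n !* n !≢0
  c : ℕ → ℕ
  c k = (n C k) * ((n C k) * (sameCTCount k * sameCTCount (n ∸ k)))

lemma1 : (m : ℕ) →
    p (2 + m) ≡ ((+ 1) / ((2 + m) * (2 + m))) *ℚ convSum (2 + m)
lemma1 m = begin
  p N
    ≡⟨ +a/b≡+c/d (S N) (N ! * N !) (1 * S N) (N * N * (M ! * M !))
         (solve 3 (λ s a f → s :* (a :* a :* (f :* f)) := con 1 :* s :* ((a :* f) :* (a :* f)))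
                refl (S N) N (M !)) ⟩
  + (1 * S N) / (N * N * (M ! * M !))
    ≡⟨ +a/b*+c/d≡+ac/bd 1 (N * N) (S N) (M ! * M !) ⟨
  (+ 1 / (N * N)) *ℚ (+ S N / (M ! * M !))
    ≡⟨ cong ((+ 1 / (N * N)) *ℚ_) (convSum-suc M) ⟨
  (+ 1 / (N * N)) *ℚ convSum N ∎
  where
  open ≡-Reasoning
  M = suc m
  N = suc M
  S = sameCTCount
  instance
    _ = N !* N !≢0
    _ = M !* M !≢0
    _ = m*n≢0 (N * N) (M ! * M !)
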